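{- Let $\Xi$ be a left context of atomic formulas, $P$ a positive formula, $q$ a counterpattern and $C$ a command with $C:(\Xi,q:P\vdash_S\Delta)$ derivable, and let $p$ be a pattern with $q\perp p$. Then the normal form of $C\{q\leftarrow p\}$ under the rewriting rules below is (the empty-substitution form of) a simple command $c$, and, for $q$ and $C$ fixed, the map $p\mapsto c$ from $\{p\mid q\perp p\}$ to $\{c\mid c\in C\}$ is a bijection.
   Context: Positive formulas $P::=X\mid P\otimes P\mid P\oplus P\mid\neg P$. Intermediate syntax: simple commands $c::=\langle v|e\rangle$; commands $C::=c\mid[C_1\,|_{q_1,q_2}\,C_2]$ (a copairing tree whose leaves are simple commands); expressions $v::=\widehat V\mid\mu\alpha.C$; values $V::=x\mid(V,V)\mid\mathrm{inl}(V)\mid\mathrm{inr}(V)\mid e^\bullet$; contexts $e::=\alpha\mid\tilde\mu q.C$; counterpatterns $q::=x\mid\alpha^\bullet\mid(q,q)\mid[q,q]$; patterns $p::=x\mid\alpha^\bullet\mid(p,p)\mid\mathrm{inl}(p)\mid\mathrm{inr}(p)$. Patterns and counterpatterns are linear (in $[q_1,q_2]$ a variable may occur in both $q_1$ and $q_2$, linearly in each). Typing ($\Xi$ denotes a left context of atomic formulas $x:X$; general left contexts $\Gamma$ may contain declarations $q:P$): $\Xi,x:X\vdash x:X;\Delta$; $\Xi\mid\alpha:P\vdash\alpha:P,\Delta$; $\langle v|e\rangle:(\Xi\vdash\Delta)$ from $\Xi\vdash v:P\mid\Delta$ and $\Xi\mid e:P\vdash\Delta$; $\Xi\mid\tilde\mu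 q.C:P\vdash\Delta$ from $C:(\Xi,q:P\vdash\Delta)$; $\Xi\vdash\mu\alpha.C:P\mid\Delta$ from $C:(\Xi\vdash\alpha:P,\Delta)$; $\widehat V:P$ from $V:P$; $e^\bullet:\neg P$, pairs and injections as usual; $C:(\Gamma,\alpha^\bullet:\neg P\vdash\Delta)$ from $C:(\Gamma\vdash\alpha:P,\Delta)$; $C:(\Gamma,(q_1,q_2):P_1\otimes P_2\vdash\Delta)$ from $C:(\Gamma,q_1:P_1,q_2:P_2\vdash\Delta)$; $[C_1|_{q_1,q_2}C_2]:(\Gamma,[q_1,q_2]:P_1\oplus P_2\vdash\Delta)$ from $C_i:(\Gamma,q_i:P_i\vdash\Delta)$. Orthogonality $q\perp p$: $x\perp x$; $\alpha^\bullet\perp\alpha^\bullet$; $(q_1,q_2)\perp(p_1,p_2)$ if $q_i\perp p_i$; $[q_1,q_2]\perp\mathrm{inl}(p_1)$ if $q_1\perp p_1$; $[q_1,q_2]\perp\mathrm{inr}(p_2)$ if $q_2\perp p_2$. Leaves: $c\in c$; $c\in[C_1|_{q_1,q_2}C_2]$ if $c\in C_1$ or $c\in C_2$. For a list $\sigma$ of pairs $q\leftarrow p$, rewriting of $C\{\sigma\}$: $C\{(q_1,q_2)\leftarrow(p_1,p_2),\sigma\}\to C\{q_1\leftarrow p_1,q_2\leftarrow p_2,\sigma\}$; $[C_1|_{q_1,q_2}C_2]\{[q_1,q_2]\leftarrow\mathrm{inl}(p_1),\sigma\}\to C_1\{q_1\leftarrow p_1,\sigma\}$; $[C_1|_{q_1,q_2}C_2]\{[q_1,q_2]\leftarrow\mathrm{inr}(p_2),\sigma\}\to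 C_2\{q_2\leftarrow p_2,\sigma\}$; $C\{\alpha^\bullet\leftarrow\alpha^\bullet,\sigma\}\to C\{\sigma\}$; $C\{x\leftarrow x,\sigma\}\to C\{\sigma\}$. A term $c\{\}$ with empty list is identified with $c$. -}

module Defs where

open import Data.Nat using (ℕ)
open import Data.Product using (_×_; _,_; Σ; proj₁)
open import Data.List using (List; []; _∷_; map)
open import Data.List.Membership.Propositional using (_∈_)
open import Data.List.Relation.Binary.Permutation.Propositional using (_↭_)
open import Relation.Nullary using (¬_)
open import Data.Empty using (⊥)
open import Data.Unit using (⊤)
open import Data.List using (_++_)
open import Relation.Binary.PropositionalEquality using (_≡_)
open import Relation.Binary.Construct.Closure.ReflexiveTransitive using (Star)
open import Function.Definitions using (Bijective)

Var CoVar Atom : Set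
Var = ℕ
CoVar = ℕ
Atom = ℕ

data Formula : Set where
  atom : Atom → Formula
  _⊗_  : Formula → Formula → Formula
  _⊕_  : Formula → Formula → Formula
  ¬ᶠ_  : Formula → Formula

data CPat : Set where
  cvar  : Var → CPat
  cbul  : CoVar → CPat
  cpair : CPat → CPat → CPat
  ccase : CPat → CPat → CPat

data Pat : Set where
  pvar  : Var → Pat
  pbul  : CoVar → Pat
  ppair : Pat → Pat → Pat
  pinl  : Pat → Pat
  pinr  : Pat → Pat

mutual
  data SCmd : Set where
    ⟨_∣_⟩ : Expr → Ctx → SCmd

  data Cmd : Set where
    simple : SCmd → Cmd
    copair : Cmd → CPat → CPat → Cmd → Cmd

  data Expr : Set where
    hat : Val → Expr
    mu  : CoVar → Cmd → Expr

  data Val : Set where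
    var    : Var → Val
    pair   : Val → Val → Val
    inl    : Val → Val
    inr    : Val → Val
    bullet : Ctx → Val

  data Ctx : Set where
    covar   : CoVar → Ctx
    mutilde : CPat → Cmd → Ctx

-- Linearity of (counter)patterns -------------------------------------
-- (in [q₁,q₂] a name may occur in both q₁ and q₂, linearly in each)

data Name : Set where
  nvar : Var → Name
  ncov : CoVar → Name

Disjoint : List Name → List Name → Set
Disjoint xs ys = ∀ {n} → n ∈ xs → n ∈ ys → ⊥

cnames : CPat → List Name
cnames (cvar x)      = nvar x ∷ []
cnames (cbul α)      = ncov α ∷ []
cnames (cpair q₁ q₂) = cnames q₁ ++ cnames q₂
cnames (ccase q₁ q₂) = cnames q₁ ++ cnames q₂

LinearC : CPat → Set
LinearC (cvar x)      = ⊤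
LinearC (cbul α)      = ⊤
LinearC (cpair q₁ q₂) = LinearC q₁ × LinearC q₂ × Disjoint (cnames q₁) (cnames q₂)
LinearC (ccase q₁ q₂) = LinearC q₁ × LinearC q₂

pnames : Pat → List Name
pnames (pvar x)      = nvar x ∷ []
pnames (pbul α)      = ncov α ∷ []
pnames (ppair p₁ p₂) = pnames p₁ ++ pnames p₂
pnames (pinl p)      = pnames p
pnames (pinr p)      = pnames p

LinearP : Pat → Set
LinearP (pvar x)      = ⊤
LinearP (pbul α)      = ⊤
LinearP (ppair p₁ p₂) = LinearP p₁ × LinearP p₂ × Disjoint (pnames p₁) (pnames p₂)
LinearP (pinl p)      = LinearP p
LinearP (pinr p)      = LinearP p

AtomCtx : Set
AtomCtx = List (Var × Atom)

RCtx : Set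
RCtx = List (CoVar × Formula)

LCtx : Set
LCtx = List (CPat × Formula)

embed : AtomCtx → LCtx
embed = map (λ { (x , X) → (cvar x , atom X) })

mutual
  data CmdTy : LCtx → RCtx → Cmd → Set where
    ty-simple : ∀ {Ξ Δ c} → SCmdTy Ξ Δ c → CmdTy (embed Ξ) Δ (simple c)
    ty-exch   : ∀ {Γ Γ′ Δ C} → Γ ↭ Γ′ → CmdTy Γ Δ C → CmdTy Γ′ Δ C
    ty-neg    : ∀ {Γ Δ C α P} → CmdTy Γ ((α , P) ∷ Δ) C →
                CmdTy ((cbul α , ¬ᶠ P) ∷ Γ) Δ C
    ty-tensor : ∀ {Γ Δ C q₁ q₂ P₁ P₂} → CmdTy ((q₁ , P₁) ∷ (q₂ , P₂) ∷ Γ) Δ C →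
                CmdTy ((cpair q₁ q₂ , P₁ ⊗ P₂) ∷ Γ) Δ C
    ty-plus   : ∀ {Γ Δ C₁ C₂ q₁ q₂ P₁ P₂} →
                CmdTy ((q₁ , P₁) ∷ Γ) Δ C₁ → CmdTy ((q₂ , P₂) ∷ Γ) Δ C₂ →
                CmdTy ((ccase q₁ q₂ , P₁ ⊕ P₂) ∷ Γ) Δ (copair C₁ q₁ q₂ C₂)

  data SCmdTy : AtomCtx → RCtx → SCmd → Set where
    ty-cut : ∀ {Ξ Δ v e P} → ExprTy Ξ v P Δ → CtxTy Ξ e P Δ → SCmdTy Ξ Δ ⟨ v ∣ e ⟩

  data ExprTy : AtomCtx → Expr → Formula → RCtx → Set where
    ty-hat : ∀ {Ξ V P Δ} → ValTy Ξ V P Δ → ExprTy Ξ (hat V) P Δ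
    ty-mu  : ∀ {Ξ α C P Δ} → CmdTy (embed Ξ) ((α , P) ∷ Δ) C → ExprTy Ξ (mu α C) P Δ

  data CtxTy : AtomCtx → Ctx → Formula → RCtx → Set where
    ty-covar : ∀ {Ξ α P Δ} → (α , P) ∈ Δ → CtxTy Ξ (covar α) P Δ
    ty-mut   : ∀ {Ξ q C P Δ} → CmdTy ((q , P) ∷ embed Ξ) Δ C → CtxTy Ξ (mutilde q C) P Δ

  data ValTy : AtomCtx → Val → Formula → RCtx → Set where
    ty-var    : ∀ {Ξ x X Δ} → (x , X) ∈ Ξ → ValTy Ξ (var x) (atom X) Δ
    ty-pair   : ∀ {Ξ V₁ V₂ P₁ P₂ Δ} → ValTy Ξ V₁ P₁ Δ → ValTy Ξ V₂ P₂ Δ →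
                ValTy Ξ (pair V₁ V₂) (P₁ ⊗ P₂) Δ
    ty-inl    : ∀ {Ξ V P₁ P₂ Δ} → ValTy Ξ V P₁ Δ → ValTy Ξ (inl V) (P₁ ⊕ P₂) Δ
    ty-inr    : ∀ {Ξ V P₁ P₂ Δ} → ValTy Ξ V P₂ Δ → ValTy Ξ (inr V) (P₁ ⊕ P₂) Δ
    ty-bullet : ∀ {Ξ e P Δ} → CtxTy Ξ e P Δ → ValTy Ξ (bullet e) (¬ᶠ P) Δ

data _⊥ᵖ_ : CPat → Pat → Set where
  o-var  : ∀ {x} → cvar x ⊥ᵖ pvar x
  o-bul  : ∀ {α} → cbul α ⊥ᵖ pbul α
  o-pair : ∀ {q₁ q₂ p₁ p₂} → q₁ ⊥ᵖ p₁ → q₂ ⊥ᵖ p₂ → cpair q₁ q₂ ⊥ᵖ ppair p₁ p₂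
  o-inl  : ∀ {q₁ q₂ p₁} → q₁ ⊥ᵖ p₁ → ccase q₁ q₂ ⊥ᵖ pinl p₁
  o-inr  : ∀ {q₁ q₂ p₂} → q₂ ⊥ᵖ p₂ → ccase q₁ q₂ ⊥ᵖ pinr p₂

-- Leaves c ∈ C (as positions in the copairing tree) -------------------

data _∈ᴸ_ : SCmd → Cmd → Set where
  leaf  : ∀ {c} → c ∈ᴸ simple c
  left  : ∀ {c C₁ q₁ q₂ C₂} → c ∈ᴸ C₁ → c ∈ᴸ copair C₁ q₁ q₂ C₂
  right : ∀ {c C₁ q₁ q₂ C₂} → c ∈ᴸ C₂ → c ∈ᴸ copair C₁ q₁ q₂ C₂

Subst : Set
Subst = List (CPat × Pat)

Term : Set
Term = Cmd × Subst

data HeadStep : Term → Term → Set where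
  r-pair : ∀ {C q₁ q₂ p₁ p₂ σ} →
           HeadStep (C , (cpair q₁ q₂ , ppair p₁ p₂) ∷ σ) (C , (q₁ , p₁) ∷ (q₂ , p₂) ∷ σ)
  r-inl  : ∀ {C₁ C₂ q₁ q₂ p₁ σ} →
           HeadStep (copair C₁ q₁ q₂ C₂ , (ccase q₁ q₂ , pinl p₁) ∷ σ) (C₁ , (q₁ , p₁) ∷ σ)
  r-inr  : ∀ {C₁ C₂ q₁ q₂ p₂ σ} →
           HeadStep (copair C₁ q₁ q₂ C₂ , (ccase q₁ q₂ , pinr p₂) ∷ σ) (C₂ , (q₂ , p₂) ∷ σ)
  r-bul  : ∀ {C α σ} → HeadStep (C , (cbul α , pbul α) ∷ σ) (C , σ)
  r-var  : ∀ {C x σ} → HeadStep (C , (cvar x , pvar x) ∷ σ) (C , σ)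

-- the substitution list is taken up to reordering (like the contexts)
data Step : Term → Term → Set where
  step : ∀ {C σ σ′ t} → σ ↭ σ′ → HeadStep (C , σ′) t → Step (C , σ) t

_⟶*_ : Term → Term → Set
_⟶*_ = Star Step

Normal : Term → Set
Normal t = ∀ t′ → ¬ Step t t′

module Submission where

-- An instance of a left context assigns to each declaration q′ : P′
-- a pattern orthogonal to q′.  Recursion on typing derivations gives mutually
-- inverse maps leafOf/instanceOf between instances and leaves of C (a copair
-- is resolved by the side chosen by the pattern of its case counterpattern).
-- The atomic context Ξ has a unique instance, so instances of (q : P, Ξ) are
-- patterns p ⊥ q, and f(p) = leafOf d (p, Ξ) is a bijection.
--
-- A pattern p makes a choice of side for each case [q₁,q₂] in
-- q; linearity of q makes these choices functional, and they select the leaf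
-- f(p) in C.  Along any reduction from C{q ← p} an invariant holds: the
-- pending substitution is orthogonal, its cases match the copair spine of the
-- current command, and the current command still selects f(p).  Every
-- invariant term other than f(p){} steps, and pattern sizes decrease, so
-- f(p){} is reached and is the only reachable normal form.

open import Defs
open import Data.Product using (Σ; _×_; _,_; proj₁; proj₂; ∃; ∃₂; map₂)
open import Data.Sum using (_⊎_; inj₁; inj₂)
open import Data.Empty using (⊥; ⊥-elim)
open import Relation.Nullary using (¬_)
open import Data.Nat using (ℕ; suc; _+_; _≤_; _<_; s≤s)
open import Data.Nat.Properties using (≤-refl; ≤-reflexive; ≤-trans; <⇒≱; m≤m+n; m≤n+m; +-assoc)
open import Data.Nat.Induction using (<-wellFounded)
open import Data.Nat.ListAction using (sum)
open import Data.Nat.ListAction.Properties using (sum-↭)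
open import Induction.WellFounded using (Acc; acc)
open import Data.List using (List; []; _∷_; _++_; map)
open import Data.List.Properties using (++-assoc)
open import Data.List.Relation.Unary.All using (All; []; _∷_; head; lookup)
open import Data.List.Relation.Unary.Any using (here; there)
open import Data.List.Membership.Propositional using (_∈_)
open import Data.List.Membership.Propositional.Properties using (∈-++⁺ˡ; ∈-++⁺ʳ; ∈-++⁻; ∈-∃++)
open import Data.List.Relation.Binary.Subset.Propositional using (_⊆_)
open import Data.List.Relation.Binary.Permutation.Propositional using (_↭_; ↭-sym; ↭-trans; ↭-reflexive)
import Data.List.Relation.Binary.Permutation.Propositional as Perm
open import Data.List.Relation.Binary.Permutation.Propositional.Properties
  using (All-resp-↭; ∈-resp-↭; ¬x∷xs↭[]; ++⁺ˡ; shift; shifts; drop-∷; map⁺)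
open import Relation.Binary.PropositionalEquality using (_≡_; refl; sym; trans; cong; subst)
open import Relation.Binary.Construct.Closure.ReflexiveTransitive using (ε; _◅_)
open import Function.Definitions using (Bijective)
open import Function.Consequences.Propositional
  using (inverseᵇ⇒bijective; strictlyInverseˡ⇒inverseˡ; strictlyInverseʳ⇒inverseʳ)

inverse⇒bijective : ∀ {A B : Set} (f : A → B) (g : B → A) →
                    (∀ y → f (g y) ≡ y) → (∀ x → g (f x) ≡ x) → Bijective _≡_ _≡_ f
inverse⇒bijective f g fg gf =
  inverseᵇ⇒bijective (strictlyInverseˡ⇒inverseˡ f fg , strictlyInverseʳ⇒inverseʳ f gf)

bring-to-front : ∀ {A : Set} {x : A} {xs} → x ∈ xs → ∃ λ ys → xs ↭ x ∷ ys
bring-to-front {x = x} m with ∈-∃++ m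
... | ys , zs , refl = ys ++ zs , shift x ys zs

Instance : LCtx → Set
Instance = All (λ decl → Σ Pat (proj₁ decl ⊥ᵖ_))

substOf : ∀ {Γ} → Instance Γ → Subst
substOf {[]}          []             = []
substOf {(q , _) ∷ Γ} ((p , _) ∷ α) = (q , p) ∷ substOf α

reorder-there-back : ∀ {Γ Γ′} (π : Γ ↭ Γ′) (α : Instance Γ) →
                     All-resp-↭ (↭-sym π) (All-resp-↭ π α) ≡ α
reorder-there-back Perm.refl          α           = refl
reorder-there-back (Perm.prep _ π)    (a ∷ α)     = cong (a ∷_) (reorder-there-back π α)
reorder-there-back (Perm.swap _ _ π)  (a ∷ b ∷ α) = cong (λ β → a ∷ b ∷ β) (reorder-there-back π α)
reorder-there-back (Perm.trans π ρ)   α           =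
  trans (cong (All-resp-↭ (↭-sym π)) (reorder-there-back ρ (All-resp-↭ π α)))
        (reorder-there-back π α)

reorder-back-there : ∀ {Γ Γ′} (π : Γ ↭ Γ′) (α : Instance Γ′) →
                     All-resp-↭ π (All-resp-↭ (↭-sym π) α) ≡ α
reorder-back-there Perm.refl          α           = refl
reorder-back-there (Perm.prep _ π)    (a ∷ α)     = cong (a ∷_) (reorder-back-there π α)
reorder-back-there (Perm.swap _ _ π)  (b ∷ a ∷ α) = cong (λ β → b ∷ a ∷ β) (reorder-back-there π α)
reorder-back-there (Perm.trans π ρ)   α           =
  trans (cong (All-resp-↭ ρ) (reorder-back-there π (All-resp-↭ (↭-sym ρ) α)))
        (reorder-back-there ρ α)

substOf-reorder : ∀ {Γ Γ′} (π : Γ ↭ Γ′) (α : Instance Γ) → substOf (All-resp-↭ π α) ↭ substOf α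
substOf-reorder Perm.refl         α           = Perm.refl
substOf-reorder (Perm.prep _ π)   (a ∷ α)     = Perm.prep _ (substOf-reorder π α)
substOf-reorder (Perm.swap _ _ π) (a ∷ b ∷ α) = Perm.swap _ _ (substOf-reorder π α)
substOf-reorder (Perm.trans π ρ)  α           =
  ↭-trans (substOf-reorder ρ (All-resp-↭ π α)) (substOf-reorder π α)

varInstance : ∀ Ξ → Instance (embed Ξ)
varInstance []            = []
varInstance ((x , _) ∷ Ξ) = (pvar x , o-var) ∷ varInstance Ξ

varInstance-unique : ∀ Ξ (α : Instance (embed Ξ)) → α ≡ varInstance Ξ
varInstance-unique []            []                 = refl
varInstance-unique ((x , _) ∷ Ξ) ((_ , o-var) ∷ α) = cong (_ ∷_) (varInstance-unique Ξ α)

Leaves : Cmd → Set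
Leaves C = Σ SCmd (_∈ᴸ C)

leafOf : ∀ {Γ Δ C} → CmdTy Γ Δ C → Instance Γ → Leaves C
leafOf (ty-simple {c = c} _) α                          = c , leaf
leafOf (ty-exch π d)         α                          = leafOf d (All-resp-↭ (↭-sym π) α)
leafOf (ty-neg d)            (_ ∷ α)                    = leafOf d α
leafOf (ty-tensor d)         ((_ , o-pair o₁ o₂) ∷ α)   = leafOf d ((_ , o₁) ∷ (_ , o₂) ∷ α)
leafOf (ty-plus d₁ d₂)       ((_ , o-inl o) ∷ α)        = map₂ left (leafOf d₁ ((_ , o) ∷ α))
leafOf (ty-plus d₁ d₂)       ((_ , o-inr o) ∷ α)        = map₂ right (leafOf d₂ ((_ , o) ∷ α))

instanceOf : ∀ {Γ Δ C} → CmdTy Γ Δ C → Leaves C → Instance Γ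
instanceOf (ty-simple {Ξ = Ξ} _) l             = varInstance Ξ
instanceOf (ty-exch π d)         l             = All-resp-↭ π (instanceOf d l)
instanceOf (ty-neg {α = a} d)    l             = (pbul a , o-bul) ∷ instanceOf d l
instanceOf (ty-tensor d)         l             with instanceOf d l
... | (p₁ , o₁) ∷ (p₂ , o₂) ∷ α = (ppair p₁ p₂ , o-pair o₁ o₂) ∷ α
instanceOf (ty-plus d₁ d₂)       (c , left i)  with instanceOf d₁ (c , i)
... | (p , o) ∷ α = (pinl p , o-inl o) ∷ α
instanceOf (ty-plus d₁ d₂)       (c , right i) with instanceOf d₂ (c , i)
... | (p , o) ∷ α = (pinr p , o-inr o) ∷ α

leafOf-instanceOf : ∀ {Γ Δ C} (d : CmdTy Γ Δ C) l → leafOf d (instanceOf d l) ≡ l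
leafOf-instanceOf (ty-simple _)   (_ , leaf)    = refl
leafOf-instanceOf (ty-exch π d)   l             =
  trans (cong (leafOf d) (reorder-there-back π (instanceOf d l))) (leafOf-instanceOf d l)
leafOf-instanceOf (ty-neg d)      l             = leafOf-instanceOf d l
leafOf-instanceOf (ty-tensor d)   l             with instanceOf d l | leafOf-instanceOf d l
... | _ ∷ _ ∷ _ | eq = eq
leafOf-instanceOf (ty-plus d₁ d₂) (c , left i)  with instanceOf d₁ (c , i) | leafOf-instanceOf d₁ (c , i)
... | _ ∷ _ | eq = cong (map₂ left) eq
leafOf-instanceOf (ty-plus d₁ d₂) (c , right i) with instanceOf d₂ (c , i) | leafOf-instanceOf d₂ (c , i)
... | _ ∷ _ | eq = cong (map₂ right) eq

instanceOf-leafOf : ∀ {Γ Δ C} (d : CmdTy Γ Δ C) α → instanceOf d (leafOf d α) ≡ α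
instanceOf-leafOf (ty-simple {Ξ = Ξ} _) α = sym (varInstance-unique Ξ α)
instanceOf-leafOf (ty-exch π d) α =
  trans (cong (All-resp-↭ π) (instanceOf-leafOf d (All-resp-↭ (↭-sym π) α))) (reorder-back-there π α)
instanceOf-leafOf (ty-neg d) ((_ , o-bul) ∷ α) = cong (_ ∷_) (instanceOf-leafOf d α)
instanceOf-leafOf (ty-tensor d) ((_ , o-pair o₁ o₂) ∷ α)
  rewrite instanceOf-leafOf d ((_ , o₁) ∷ (_ , o₂) ∷ α) = refl
instanceOf-leafOf (ty-plus d₁ d₂) ((_ , o-inl o) ∷ α)
  rewrite instanceOf-leafOf d₁ ((_ , o) ∷ α) = refl
instanceOf-leafOf (ty-plus d₁ d₂) ((_ , o-inr o) ∷ α)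
  rewrite instanceOf-leafOf d₂ ((_ , o) ∷ α) = refl

data Side : Set where
  inlSide inrSide : Side

Choices : Set
Choices = List (CPat × Side)

choices : CPat → Pat → Choices
choices (cpair q₁ q₂)   (ppair p₁ p₂) = choices q₁ p₁ ++ choices q₂ p₂
choices (ccase q₁ q₂)   (pinl p)      = (ccase q₁ q₂ , inlSide) ∷ choices q₁ p
choices (ccase q₁ q₂)   (pinr p)      = (ccase q₁ q₂ , inrSide) ∷ choices q₂ p
choices _               _             = []

ChoicesIn : Choices → Subst → Set
ChoicesIn K = All (λ e → choices (proj₁ e) (proj₂ e) ⊆ K)

Functional : Choices → Set
Functional K = ∀ {k s s′} → (k , s) ∈ K → (k , s′) ∈ K → s ≡ s′

data Selects (K : Choices) : Cmd → SCmd → Set where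
  sel-leaf  : ∀ {c} → Selects K (simple c) c
  sel-left  : ∀ {C₁ q₁ q₂ C₂ c} → (ccase q₁ q₂ , inlSide) ∈ K →
              Selects K C₁ c → Selects K (copair C₁ q₁ q₂ C₂) c
  sel-right : ∀ {C₁ q₁ q₂ C₂ c} → (ccase q₁ q₂ , inrSide) ∈ K →
              Selects K C₂ c → Selects K (copair C₁ q₁ q₂ C₂) c

leafOf-selected : ∀ {Γ Δ C K} (d : CmdTy Γ Δ C) (α : Instance Γ) →
                  ChoicesIn K (substOf α) → Selects K C (proj₁ (leafOf d α))
leafOf-selected (ty-simple _) α w = sel-leaf
leafOf-selected (ty-exch π d) α w =
  leafOf-selected d _ (All-resp-↭ (↭-sym (substOf-reorder (↭-sym π) α)) w)
leafOf-selected (ty-neg d) ((_ , o-bul) ∷ α) (_ ∷ w) = leafOf-selected d α w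
leafOf-selected (ty-tensor d) ((_ , o-pair {q₁ = q₁} {p₁ = p₁} o₁ o₂) ∷ α) (s ∷ w) =
  leafOf-selected d _ ((λ m → s (∈-++⁺ˡ m)) ∷ (λ m → s (∈-++⁺ʳ (choices q₁ p₁) m)) ∷ w)
leafOf-selected (ty-plus d₁ d₂) ((_ , o-inl o) ∷ α) (s ∷ w) =
  sel-left (s (here refl)) (leafOf-selected d₁ _ ((λ m → s (there m)) ∷ w))
leafOf-selected (ty-plus d₁ d₂) ((_ , o-inr o) ∷ α) (s ∷ w) =
  sel-right (s (here refl)) (leafOf-selected d₂ _ ((λ m → s (there m)) ∷ w))

data _⊑_ : CPat → CPat → Set where
  ⊑-refl  : ∀ {q} → q ⊑ q
  ⊑-pairˡ : ∀ {k q₁ q₂} → k ⊑ q₁ → k ⊑ cpair q₁ q₂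
  ⊑-pairʳ : ∀ {k q₁ q₂} → k ⊑ q₂ → k ⊑ cpair q₁ q₂
  ⊑-caseˡ : ∀ {k q₁ q₂} → k ⊑ q₁ → k ⊑ ccase q₁ q₂
  ⊑-caseʳ : ∀ {k q₁ q₂} → k ⊑ q₂ → k ⊑ ccase q₁ q₂

⊑-names : ∀ {k q} → k ⊑ q → cnames k ⊆ cnames q
⊑-names ⊑-refl                       m = m
⊑-names (⊑-pairˡ s)                  m = ∈-++⁺ˡ (⊑-names s m)
⊑-names (⊑-pairʳ {q₁ = q₁} s)        m = ∈-++⁺ʳ (cnames q₁) (⊑-names s m)
⊑-names (⊑-caseˡ s)                  m = ∈-++⁺ˡ (⊑-names s m)
⊑-names (⊑-caseʳ {q₁ = q₁} s)        m = ∈-++⁺ʳ (cnames q₁) (⊑-names s m)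

csize : CPat → ℕ
csize (cvar _)      = 1
csize (cbul _)      = 1
csize (cpair q₁ q₂) = suc (csize q₁ + csize q₂)
csize (ccase q₁ q₂) = suc (csize q₁ + csize q₂)

⊑-size : ∀ {k q} → k ⊑ q → csize k ≤ csize q
⊑-size ⊑-refl                    = ≤-refl
⊑-size (⊑-pairˡ {q₁ = q₁} {q₂} s) = ≤-trans (⊑-size s) (≤-trans (m≤m+n (csize q₁) (csize q₂)) (m≤n+m _ 1))
⊑-size (⊑-pairʳ {q₁ = q₁} {q₂} s) = ≤-trans (⊑-size s) (≤-trans (m≤n+m (csize q₂) (csize q₁)) (m≤n+m _ 1))
⊑-size (⊑-caseˡ {q₁ = q₁} {q₂} s) = ≤-trans (⊑-size s) (≤-trans (m≤m+n (csize q₁) (csize q₂)) (m≤n+m _ 1))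
⊑-size (⊑-caseʳ {q₁ = q₁} {q₂} s) = ≤-trans (⊑-size s) (≤-trans (m≤n+m (csize q₂) (csize q₁)) (m≤n+m _ 1))

case-⋢ˡ : ∀ {q₁ q₂} → ccase q₁ q₂ ⊑ q₁ → ⊥
case-⋢ˡ {q₁} {q₂} s = <⇒≱ (s≤s (m≤m+n (csize q₁) (csize q₂))) (⊑-size s)

case-⋢ʳ : ∀ {q₁ q₂} → ccase q₁ q₂ ⊑ q₂ → ⊥
case-⋢ʳ {q₁} {q₂} s = <⇒≱ (s≤s (m≤n+m (csize q₂) (csize q₁))) (⊑-size s)

choice-key-⊑ : ∀ {q p k s} → q ⊥ᵖ p → (k , s) ∈ choices q p → k ⊑ q
choice-key-⊑ o-var ()
choice-key-⊑ o-bul ()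
choice-key-⊑ (o-pair {q₁} {q₂} {p₁} o₁ o₂) m with ∈-++⁻ (choices q₁ p₁) m
... | inj₁ m₁ = ⊑-pairˡ (choice-key-⊑ o₁ m₁)
... | inj₂ m₂ = ⊑-pairʳ (choice-key-⊑ o₂ m₂)
choice-key-⊑ (o-inl o) (here refl) = ⊑-refl
choice-key-⊑ (o-inl o) (there m)   = ⊑-caseˡ (choice-key-⊑ o m)
choice-key-⊑ (o-inr o) (here refl) = ⊑-refl
choice-key-⊑ (o-inr o) (there m)   = ⊑-caseʳ (choice-key-⊑ o m)

someName : ∀ q → ∃ λ n → n ∈ cnames q
someName (cvar x)      = nvar x , here refl
someName (cbul α)      = ncov α , here refl
someName (cpair q₁ _)  = map₂ ∈-++⁺ˡ (someName q₁)
someName (ccase q₁ _)  = map₂ ∈-++⁺ˡ (someName q₁)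

disjoint-keys : ∀ {q₁ q₂ p₁ p₂ k s s′} → Disjoint (cnames q₁) (cnames q₂) →
                q₁ ⊥ᵖ p₁ → q₂ ⊥ᵖ p₂ → (k , s) ∈ choices q₁ p₁ → (k , s′) ∈ choices q₂ p₂ → ⊥
disjoint-keys {k = k} disjoint o₁ o₂ m₁ m₂ =
  disjoint (⊑-names (choice-key-⊑ o₁ m₁) n∈k) (⊑-names (choice-key-⊑ o₂ m₂) n∈k)
  where n∈k = proj₂ (someName k)

-- The choices of a pattern orthogonal to a linear counterpattern are
-- functional: a key below a pair lies in one component only, and a case
-- [q₁,q₂] does not recur inside its branches.
choices-functional : ∀ {q p} → LinearC q → q ⊥ᵖ p → Functional (choices q p)
choices-functional _ o-var ()
choices-functional _ o-bul ()
choices-functional (l₁ , l₂ , disjoint) (o-pair {q₁} {q₂} {p₁} o₁ o₂) m m′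
  with ∈-++⁻ (choices q₁ p₁) m | ∈-++⁻ (choices q₁ p₁) m′
... | inj₁ a | inj₁ b = choices-functional l₁ o₁ a b
... | inj₂ a | inj₂ b = choices-functional l₂ o₂ a b
... | inj₁ a | inj₂ b = ⊥-elim (disjoint-keys disjoint o₁ o₂ a b)
... | inj₂ a | inj₁ b = ⊥-elim (disjoint-keys disjoint o₁ o₂ b a)
choices-functional _        (o-inl o) (here refl) (here refl) = refl
choices-functional _        (o-inl o) (here refl) (there m)   = ⊥-elim (case-⋢ˡ (choice-key-⊑ o m))
choices-functional _        (o-inl o) (there m)   (here refl) = ⊥-elim (case-⋢ˡ (choice-key-⊑ o m))
choices-functional (l₁ , _) (o-inl o) (there m)   (there m′)  = choices-functional l₁ o m m′
choices-functional _        (o-inr o) (here refl) (here refl) = refl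
choices-functional _        (o-inr o) (here refl) (there m)   = ⊥-elim (case-⋢ʳ (choice-key-⊑ o m))
choices-functional _        (o-inr o) (there m)   (here refl) = ⊥-elim (case-⋢ʳ (choice-key-⊑ o m))
choices-functional (_ , l₂) (o-inr o) (there m)   (there m′)  = choices-functional l₂ o m m′

selects-left : ∀ {K C₁ q₁ q₂ C₂ c} → Functional K → (ccase q₁ q₂ , inlSide) ∈ K →
               Selects K (copair C₁ q₁ q₂ C₂) c → Selects K C₁ c
selects-left fK m (sel-left _ s)   = s
selects-left fK m (sel-right m′ _) with fK m m′
... | ()

selects-right : ∀ {K C₁ q₁ q₂ C₂ c} → Functional K → (ccase q₁ q₂ , inrSide) ∈ K →
                Selects K (copair C₁ q₁ q₂ C₂) c → Selects K C₂ c
selects-right fK m (sel-right _ s) = s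
selects-right fK m (sel-left m′ _) with fK m m′
... | ()

pendingCases : CPat → List CPat
pendingCases (cvar _)      = []
pendingCases (cbul _)      = []
pendingCases (cpair q₁ q₂) = pendingCases q₁ ++ pendingCases q₂
pendingCases (ccase q₁ q₂) = ccase q₁ q₂ ∷ []

pending : ∀ {B : Set} → List (CPat × B) → List CPat
pending []             = []
pending ((q , _) ∷ xs) = pendingCases q ++ pending xs

pending-↭ : ∀ {B : Set} {xs ys : List (CPat × B)} → xs ↭ ys → pending xs ↭ pending ys
pending-↭ Perm.refl = Perm.refl
pending-↭ (Perm.prep (q , _) π) = ++⁺ˡ (pendingCases q) (pending-↭ π)
pending-↭ (Perm.swap (q , _) (q′ , _) π) =
  ↭-trans (shifts (pendingCases q) (pendingCases q′))
          (++⁺ˡ (pendingCases q′) (++⁺ˡ (pendingCases q) (pending-↭ π)))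
pending-↭ (Perm.trans π ρ) = ↭-trans (pending-↭ π) (pending-↭ ρ)

pending-source : ∀ {B : Set} {k} (xs : List (CPat × B)) → k ∈ pending xs →
                 ∃ λ e → e ∈ xs × k ∈ pendingCases (proj₁ e)
pending-source ((q , b) ∷ xs) m with ∈-++⁻ (pendingCases q) m
... | inj₁ m₁ = (q , b) , here refl , m₁
... | inj₂ m₂ with pending-source xs m₂
...   | e , e∈xs , k∈e = e , there e∈xs , k∈e

pending-embed : ∀ Ξ → pending (embed Ξ) ≡ []
pending-embed []      = refl
pending-embed (_ ∷ Ξ) = pending-embed Ξ

-- Spine F C: the copair tree of C is resolved by the pending cases F
-- (up to order): a simple command has none pending, and
-- [C₁ |_{q₁,q₂} C₂] consumes [q₁,q₂], each branch seeing the cases of q₁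
-- (resp. q₂) instead.
data Spine : List CPat → Cmd → Set where
  spine-simple : ∀ {F c} → F ↭ [] → Spine F (simple c)
  spine-copair : ∀ {F R C₁ q₁ q₂ C₂} → F ↭ ccase q₁ q₂ ∷ R →
                 Spine (pendingCases q₁ ++ R) C₁ → Spine (pendingCases q₂ ++ R) C₂ →
                 Spine F (copair C₁ q₁ q₂ C₂)

spine-resp : ∀ {F F′ C} → F ↭ F′ → Spine F C → Spine F′ C
spine-resp π (spine-simple ρ)       = spine-simple (↭-trans (↭-sym π) ρ)
spine-resp π (spine-copair ρ s₁ s₂) = spine-copair (↭-trans (↭-sym π) ρ) s₁ s₂

typed⇒spine : ∀ {Γ Δ C} → CmdTy Γ Δ C → Spine (pending Γ) C
typed⇒spine (ty-simple {Ξ = Ξ} _) = spine-simple (↭-reflexive (pending-embed Ξ))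
typed⇒spine (ty-exch π d)         = spine-resp (pending-↭ π) (typed⇒spine d)
typed⇒spine (ty-neg d)            = typed⇒spine d
typed⇒spine (ty-tensor {Γ = Γ} {q₁ = q₁} {q₂ = q₂} d) =
  spine-resp (↭-reflexive (sym (++-assoc (pendingCases q₁) (pendingCases q₂) (pending Γ)))) (typed⇒spine d)
typed⇒spine (ty-plus d₁ d₂)       = spine-copair Perm.refl (typed⇒spine d₁) (typed⇒spine d₂)

Orth : CPat × Pat → Set
Orth (q , p) = q ⊥ᵖ p

data Invariant (K : Choices) (c₀ : SCmd) : Term → Set where
  invariant : ∀ {C σ} → All Orth σ → Spine (pending σ) C → ChoicesIn K σ →
              Selects K C c₀ → Invariant K c₀ (C , σ)

-- Each rewriting rule preserves the invariant; for a copair the pending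
-- choice agrees with K, so the selection continues into the branch taken.
preserved-head : ∀ {K c₀ s t} → Functional K → HeadStep s t → Invariant K c₀ s → Invariant K c₀ t
preserved-head fK (r-pair {q₁ = q₁} {q₂} {p₁} {σ = σ}) (invariant (o-pair o₁ o₂ ∷ os) sp (w ∷ ws) sel) =
  invariant (o₁ ∷ o₂ ∷ os)
            (spine-resp (↭-reflexive (++-assoc (pendingCases q₁) (pendingCases q₂) (pending σ))) sp)
            ((λ m → w (∈-++⁺ˡ m)) ∷ (λ m → w (∈-++⁺ʳ (choices q₁ p₁) m)) ∷ ws) sel
preserved-head fK (r-inl {q₁ = q₁}) (invariant (o-inl o ∷ os) (spine-copair ρ sp₁ _) (w ∷ ws) sel) =
  invariant (o ∷ os) (spine-resp (++⁺ˡ (pendingCases q₁) (↭-sym (drop-∷ ρ))) sp₁)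
            ((λ m → w (there m)) ∷ ws) (selects-left fK (w (here refl)) sel)
preserved-head fK (r-inr {q₂ = q₂}) (invariant (o-inr o ∷ os) (spine-copair ρ _ sp₂) (w ∷ ws) sel) =
  invariant (o ∷ os) (spine-resp (++⁺ˡ (pendingCases q₂) (↭-sym (drop-∷ ρ))) sp₂)
            ((λ m → w (there m)) ∷ ws) (selects-right fK (w (here refl)) sel)
preserved-head fK r-bul (invariant (_ ∷ os) sp (_ ∷ ws) sel) = invariant os sp ws sel
preserved-head fK r-var (invariant (_ ∷ os) sp (_ ∷ ws) sel) = invariant os sp ws sel

preserved : ∀ {K c₀ s t} → Functional K → s ⟶* t → Invariant K c₀ s → Invariant K c₀ t
preserved fK ε                  I = I
preserved fK (step π h ◅ steps) (invariant os sp ws sel) =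
  preserved fK steps
    (preserved-head fK h (invariant (All-resp-↭ π os) (spine-resp (pending-↭ π) sp) (All-resp-↭ π ws) sel))

head-redex : ∀ {C q p} τ → q ⊥ᵖ p →
             (∀ {q₁ q₂} → q ≡ ccase q₁ q₂ → ∃₂ λ C₁ C₂ → C ≡ copair C₁ q₁ q₂ C₂) →
             ∃ (HeadStep (C , (q , p) ∷ τ))
head-redex τ o-var        _ = _ , r-var
head-redex τ o-bul        _ = _ , r-bul
head-redex τ (o-pair _ _) _ = _ , r-pair
head-redex τ (o-inl _) isCopair with isCopair refl
... | _ , _ , refl = _ , r-inl
head-redex τ (o-inr _) isCopair with isCopair refl
... | _ , _ , refl = _ , r-inr

pending-of-case : ∀ {q q₁ q₂ q₁′ q₂′ C₁ C₂} → q ≡ ccase q₁′ q₂′ → ccase q₁ q₂ ∈ pendingCases q →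
                  ∃₂ λ C₁′ C₂′ → copair C₁ q₁ q₂ C₂ ≡ copair C₁′ q₁′ q₂′ C₂′
pending-of-case refl (here refl) = _ , _ , refl

no-pending-case : ∀ {q q₁ q₂ F} → q ≡ ccase q₁ q₂ → ¬ (pendingCases q ++ F ↭ [])
no-pending-case refl = ¬x∷xs↭[]

progress : ∀ {K c₀ C σ} → Invariant K c₀ (C , σ) → (C , σ) ≡ (simple c₀ , []) ⊎ ∃ (Step (C , σ))
progress {C = copair _ _ _ _} {σ} (invariant os (spine-copair ρ _ _) _ _)
  with pending-source σ (∈-resp-↭ (↭-sym ρ) (here refl))
... | e , e∈σ , case∈e with bring-to-front e∈σ
...   | τ , π = inj₂ (_ , step π (proj₂ (head-redex τ (lookup (All-resp-↭ π os) (here refl))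
                                             (λ eq → pending-of-case eq case∈e))))
progress {C = simple _} {[]}          (invariant _ _ _ sel-leaf) = inj₁ refl
progress {C = simple _} {(q , p) ∷ τ} (invariant (o ∷ _) (spine-simple ρ) _ _) =
  inj₂ (_ , step Perm.refl (proj₂ (head-redex τ o (λ eq → ⊥-elim (no-pending-case eq ρ)))))

psize : Pat → ℕ
psize (pvar _)      = 1
psize (pbul _)      = 1
psize (ppair p₁ p₂) = suc (psize p₁ + psize p₂)
psize (pinl p)      = suc (psize p)
psize (pinr p)      = suc (psize p)

weight : Subst → ℕ
weight σ = sum (map (λ e → psize (proj₂ e)) σ)

weight-decreases : ∀ {s t} → Step s t → weight (proj₂ t) < weight (proj₂ s)
weight-decreases (step π h) = ≤-trans (head-decreases h) (≤-reflexive (sum-↭ (map⁺ _ (↭-sym π))))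
  where
  head-decreases : ∀ {s t} → HeadStep s t → weight (proj₂ t) < weight (proj₂ s)
  head-decreases (r-pair {p₁ = p₁} {p₂} {σ}) = s≤s (≤-reflexive (sym (+-assoc (psize p₁) (psize p₂) (weight σ))))
  head-decreases r-inl = ≤-refl
  head-decreases r-inr = ≤-refl
  head-decreases r-bul = ≤-refl
  head-decreases r-var = ≤-refl

normalises : ∀ {K c₀ C σ} → Functional K → Acc _<_ (weight σ) → Invariant K c₀ (C , σ) →
             (C , σ) ⟶* (simple c₀ , [])
normalises fK (acc smaller) I with progress I
... | inj₁ refl      = ε
... | inj₂ (_ , st) = st ◅ normalises fK (smaller (weight-decreases st)) (preserved fK (st ◅ ε) I)

varInstance-no-choices : ∀ {K} Ξ → ChoicesIn K (substOf (varInstance Ξ))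
varInstance-no-choices []      = []
varInstance-no-choices (_ ∷ Ξ) = (λ ()) ∷ varInstance-no-choices Ξ

proposition5 : (Ξ : AtomCtx) (Δ : RCtx) (P : Formula) (q : CPat) (C : Cmd) →
    LinearC q → CmdTy ((q , P) ∷ embed Ξ) Δ C →
    Σ (Σ Pat (λ p → q ⊥ᵖ p) → Σ SCmd (λ c → c ∈ᴸ C)) λ f →
      ((p : Pat) → (o : q ⊥ᵖ p) →
        ((C , (q , p) ∷ []) ⟶* (simple (proj₁ (f (p , o))) , []))
        × ((t : Term) → (C , (q , p) ∷ []) ⟶* t → Normal t →
             t ≡ (simple (proj₁ (f (p , o))) , [])))
      × Bijective _≡_ _≡_ f
proposition5 Ξ Δ P q C linear d =
  f , (λ p o → reaches p o , unique p o) , inverse⇒bijective f g f∘g g∘f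
  where
  f : Σ Pat (q ⊥ᵖ_) → Leaves C
  f x = leafOf d (x ∷ varInstance Ξ)

  g : Leaves C → Σ Pat (q ⊥ᵖ_)
  g l = head (instanceOf d l)

  f∘g : ∀ l → f (g l) ≡ l
  f∘g l with instanceOf d l | leafOf-instanceOf d l
  ... | x ∷ α | eq = subst (λ β → leafOf d (x ∷ β) ≡ l) (varInstance-unique Ξ α) eq

  g∘f : ∀ x → g (f x) ≡ x
  g∘f x = cong head (instanceOf-leafOf d (x ∷ varInstance Ξ))

  module _ (p : Pat) (o : q ⊥ᵖ p) where
    start : Invariant (choices q p) (proj₁ (f (p , o))) (C , (q , p) ∷ [])
    start = invariant (o ∷ [])
                      (spine-resp (++⁺ˡ (pendingCases q) (↭-reflexive (pending-embed Ξ))) (typed⇒spine d))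
                      ((λ m → m) ∷ [])
                      (leafOf-selected d ((p , o) ∷ varInstance Ξ) ((λ m → m) ∷ varInstance-no-choices Ξ))

    reaches : (C , (q , p) ∷ []) ⟶* (simple (proj₁ (f (p , o))) , [])
    reaches = normalises (choices-functional linear o) (<-wellFounded _) start

    unique : (t : Term) → (C , (q , p) ∷ []) ⟶* t → Normal t → t ≡ (simple (proj₁ (f (p , o))) , [])
    unique t steps normal with progress (preserved (choices-functional linear o) steps start)
    ... | inj₁ final      = final
    ... | inj₂ (t′ , st) = ⊥-elim (normal t′ st)
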